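{- Let $\mathcal E$ be an edge replacement system and $\mathcal R_{\mathcal E}$ its associated VERS (for any choice of partitions). For every $n\ge1$, the $n$-th VERS expansion $\Gamma_n$ of $\mathcal R_{\mathcal E}$ is the barycentric subdivision of the $n$-th graph $E_n$ of the full expansion sequence of $\mathcal E$, under the following identification: the vertex $e_1\cdots e_n$ of $\Gamma_n$ (all letters edges of replacement/base graphs) is the edge $e_1\cdots e_n$ of $E_n$; the vertex $vV^{n-1}$ ($v\in V(X_0)$) is the vertex $v$ of $E_n$ coming from $X_0$; and the vertex $w\,v\,V^{n-m-1}$, where $w=e_1\cdots e_m$ is an edge of $E_m$ ($m<n$) of color $c$ and $v\in V(X_c)\setminus\{\iota_c,\tau_c\}$, is the copy of $v$ created when $w$ was expanded; colors $c_\iota,c_\tau$ of $\Gamma_n$ correspond to the barycentric colors.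
   Context: Graphs have vertex set, edge set and maps $\iota,\tau$; loops and parallel edges allowed; words are read left to right and letters are appended on the right. ERS $\mathcal E$: a finite color set $C$, a finite base graph $X_0$ with edges colored by $C$, and for each $c\in C$ a finite replacement graph $X_c$ with $C$-colored edges and distinguished vertices $\iota_c,\tau_c$. Expanding a $c$-colored edge $e$ replaces it with a copy of $X_c$, identifying $\iota_c$ with $\iota(e)$ and $\tau_c$ with $\tau(e)$. Full expansion sequence: $E_1=X_0$ and $E_{n+1}$ is obtained from $E_n$ by expanding every edge; the edges of $E_n$ are the words $e_1\cdots e_n$ with $e_1\in E(X_0)$ and $e_{i+1}\in E(X_{\mathrm{col}(e_i)})$, the color of $e_1\cdots e_n$ being $\mathrm{col}(e_n)$. Barycentric subdivision $\mathrm{bar}(Y)$ of a $C$-colored graph $Y$: vertex set $V(Y)\sqcup E(Y)$, and for each edge $e$ of color $c$ an edge $\iota(e)\to e$ colored $c_\iota$ and an edge $e\to\tau(e)$ colored $c_\tau$ ($C_\iota,C_\tau$ disjoint copies of $C$). VERS $\mathcal R_{\mathcal E}$: $\Sigma$ has vertex set $C\sqcup\{\ast,s\}$ and edges: a loop $V$ at $\ast$; $e\colon c\to c'$ for each edge $e$ of $X_c$ of color $c'$; $v\colon c\to\ast$ for each $v\in V(X_c)\setminus\{\iota_c,\tau_c\}$; $e\colon s\to c$ for each edge $e$ of $X_0$ of color $c$; $v\colon s\to\ast$ for each $v\in V(X_0)$ (labels distinct). Types: the type of a word is the terminal vertex of its path in $\Sigma$ starting at $s$. Colors $\{c_0\}\sqcup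 C_\iota\sqcup C_\tau$, $\kappa(c_0)=(s,s)$, $\kappa(c_\iota)=(\ast,c)$, $\kappa(c_\tau)=(c,\ast)$. For each $c$ fix a partition of $\mathrm{bar}(X_c)$ into subgraphs $B_\iota,B_\tau$ (vertex sets covering all vertices, edge sets disjoint and covering all edges) with $\tau_c\notin V(B_\iota)$, $\iota_c\notin V(B_\tau)$. $R_{c_\iota}$: vertex set $\{\mathrm iV\}\cup\{\mathrm ty:\iota(y)=c\}$, edges those of $B_\iota$ renamed by $\iota_c\mapsto\mathrm iV$, $z\mapsto\mathrm tz$ otherwise. $R_{c_\tau}$: vertex set $\{\mathrm iy:\iota(y)=c\}\cup\{\mathrm tV\}$, edges those of $B_\tau$ renamed by $\tau_c\mapsto\mathrm tV$, $z\mapsto\mathrm iz$ otherwise. $R_{c_0}$: for each edge $e$ of $X_0$ of color $c$, a $c_\iota$-colored edge $\mathrm i\,\iota(e)\to\mathrm te$ and a $c_\tau$-colored edge $\mathrm ie\to\mathrm t\,\tau(e)$. $\Gamma_0$: one $c_0$-colored loop at the empty word $\varepsilon$. VERS expansion of a graph $\Gamma$ with typed vertices: vertices $ux$ ($u\in V(\Gamma)$, $x\in E(\Sigma)$, $\iota(x)=\mathrm{type}(u)$); for each edge of $\Gamma$ from $u$ to $v$ of color $c'$ and each edge of $R_{c'}$, an edge of the same color with $\mathrm i$ replaced by $u$ and $\mathrm t$ by $v$ in its endpoints. $\Gamma_{n+1}$ is the expansion of $\Gamma_n$. -}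

module Defs where

open import Data.Nat using (ℕ; zero; suc)
open import Data.Fin using (Fin; _≟_)
open import Data.Product using (Σ; _×_; _,_; proj₁; proj₂; Σ-syntax)
open import Data.Sum using (_⊎_; inj₁; inj₂)
open import Data.Unit using (⊤; tt)
open import Data.Empty using (⊥; ⊥-elim)
open import Relation.Nullary using (¬_; Dec; yes; no)
open import Relation.Nullary.Decidable using (False; fromWitnessFalse)
open import Relation.Binary.PropositionalEquality using (_≡_; refl; subst)

record Graph (C : Set) : Set₁ where
  field
    V E : Set
    ι τ : E → V
    col : E → C

-- the two copies C_ι, C_τ of the colour set are encoded as Side × C
data Side : Set where
  sι sτ : Side

bar : {C : Set} → Graph C → Graph (Side × C)
bar {C} Y = record { V = V ⊎ E ; E = E × Side ; ι = bι ; τ = bτ ; col = bcol }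
  where
  open Graph Y
  bι : E × Side → V ⊎ E
  bι (e , sι) = inj₁ (ι e)
  bι (e , sτ) = inj₂ e
  bτ : E × Side → V ⊎ E
  bτ (e , sι) = inj₂ e
  bτ (e , sτ) = inj₁ (τ e)
  bcol : E × Side → Side × C
  bcol (e , s) = s , col e

record FinCGraph (k : ℕ) : Set where
  field
    nV nE : ℕ
    src tgt : Fin nE → Fin nV
    col : Fin nE → Fin k

toGraph : {k : ℕ} → FinCGraph k → Graph (Fin k)
toGraph X = record { V = Fin nV ; E = Fin nE ; ι = src ; τ = tgt ; col = col }
  where open FinCGraph X

record ERS : Set where
  field
    nC : ℕ
    X₀ : FinCGraph nC
    X : Fin nC → FinCGraph nC
    ιc τc : (c : Fin nC) → Fin (FinCGraph.nV (X c))

module _ (ℰ : ERS) where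
  open ERS ℰ
  open FinCGraph

  Interior : Fin nC → Set
  Interior c = Σ[ v ∈ Fin (nV (X c)) ] (False (v ≟ ιc c) × False (v ≟ τc c))

  -- Full expansion sequence E_n (n ≥ 1; E_1 = X₀)

  data EW : ℕ → Fin nC → Set where
    base : (e : Fin (nE X₀)) → EW 1 (col X₀ e)
    _∷ʳ_ : ∀ {n c} → EW n c → (e : Fin (nE (X c))) → EW (suc n) (col (X c) e)

  -- vertices of E_n: those of X₀, kept at every stage (old), and, for each
  -- edge w of E_n of colour c and interior vertex v of X_c, the copy of v
  -- created when w is expanded (a vertex of E_{n+1})
  data EV : ℕ → Set where
    vb : Fin (nV X₀) → EV 1
    old : ∀ {n} → EV n → EV (suc n)
    new : ∀ {n c} → EW n c → Interior c → EV (suc n)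

  ιE τE : ∀ {n c} → EW n c → EV n
  -- where the vertex v of the copy of X_c replacing w sits in E_{n+1}
  place : ∀ {n c} → EW n c → Fin (nV (X c)) → EV (suc n)

  ιE (base e) = vb (src X₀ e)
  ιE (w ∷ʳ e) = place w (src (X _) e)
  τE (base e) = vb (tgt X₀ e)
  τE (w ∷ʳ e) = place w (tgt (X _) e)

  place {c = c} w v with v ≟ ιc c | v ≟ τc c
  ... | yes _ | _ = old (ιE w)
  ... | no _ | yes _ = old (τE w)
  ... | no a | no b = new w (v , fromWitnessFalse a , fromWitnessFalse b)

  Egraph : ℕ → Graph (Fin nC)
  Egraph n = record
    { V = EV n ; E = Σ[ c ∈ Fin nC ] EW n c
    ; ι = λ w → ιE (proj₂ w) ; τ = λ w → τE (proj₂ w) ; col = proj₁ }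

  barX : Fin nC → Graph (Side × Fin nC)
  barX c = bar (toGraph (X c))

  record Partition (c : Fin nC) : Set₁ where
    field
      side : Graph.E (barX c) → Side
      inVι inVτ : Graph.V (barX c) → Set
      cover : ∀ z → inVι z ⊎ inVτ z
      subι : ∀ f → side f ≡ sι →
               inVι (Graph.ι (barX c) f) × inVι (Graph.τ (barX c) f)
      subτ : ∀ f → side f ≡ sτ →
               inVτ (Graph.ι (barX c) f) × inVτ (Graph.τ (barX c) f)
      τ∉Bι : ¬ inVι (inj₁ (τc c))
      ι∉Bτ : ¬ inVτ (inj₁ (ιc c))

  data ΣV : Set where
    vc : Fin nC → ΣV
    ⋆ s : ΣV

  data ΣE : ΣV → ΣV → Set where
    eV : ΣE ⋆ ⋆
    eX : (c : Fin nC) (e : Fin (nE (X c))) → ΣE (vc c) (vc (col (X c) e))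
    vX : (c : Fin nC) → Interior c → ΣE (vc c) ⋆
    e0 : (e : Fin (nE X₀)) → ΣE s (vc (col X₀ e))
    v0 : Fin (nV X₀) → ΣE s ⋆

  data Col : Set where
    c₀ : Col
    cι cτ : Fin nC → Col

  κ : Col → ΣV × ΣV
  κ c₀ = s , s
  κ (cι c) = ⋆ , vc c
  κ (cτ c) = vc c , ⋆

  barCol : Side × Fin nC → Col
  barCol (sι , c) = cι c
  barCol (sτ , c) = cτ c

  -- vertices of a replacement graph R_c: i y (ι(y) = κ₁ c) or t y (ι(y) = κ₂ c);
  -- End c a = such vertices of type τ(y) = a.   inj₁ = i , inj₂ = t.
  End : Col → ΣV → Set
  End c a = ΣE (proj₁ (κ c)) a ⊎ ΣE (proj₂ (κ c)) a

  -- replacement graph R_c (its vertex set is all i y / t y; only edges matter)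
  record RGraph (c : Col) : Set₁ where
    field
      RE : Set
      rcol : RE → Col
      rsrc : (r : RE) → End c (proj₁ (κ (rcol r)))
      rtgt : (r : RE) → End c (proj₂ (κ (rcol r)))

  -- words (vertices of Γ_n): paths in Σ of length n starting at s, with type
  data Word : ℕ → ΣV → Set where
    ε : Word 0 s
    _▷_ : ∀ {n a b} → Word n a → ΣE a b → Word (suc n) b

  Vtx : ℕ → Set
  Vtx n = Σ ΣV (Word n)

  record TGraph (n : ℕ) : Set₁ where
    field
      GE : Set
      gcol : GE → Col
      gsrc : (g : GE) → Word n (proj₁ (κ (gcol g)))
      gtgt : (g : GE) → Word n (proj₂ (κ (gcol g)))

  module VERS (P : (c : Fin nC) → Partition c) where

    module _ (c : Fin nC) where
      open Partition (P c)

      -- renaming in R_{c_ι}: ι_c ↦ iV , z ↦ t z otherwise (z ≠ τ_c in B_ι)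
      renι : (v : Fin (nV (X c))) → inVι (inj₁ v) → End (cι c) ⋆
      renι v p with v ≟ ιc c | v ≟ τc c
      ... | yes _ | _ = inj₁ eV
      ... | no _ | yes q = ⊥-elim (τ∉Bι (subst (λ x → inVι (inj₁ x)) q p))
      ... | no a | no b = inj₂ (vX c (v , fromWitnessFalse a , fromWitnessFalse b))

      -- renaming in R_{c_τ}: τ_c ↦ tV , z ↦ i z otherwise (z ≠ ι_c in B_τ)
      renτ : (v : Fin (nV (X c))) → inVτ (inj₁ v) → End (cτ c) ⋆
      renτ v p with v ≟ τc c | v ≟ ιc c
      ... | yes _ | _ = inj₂ eV
      ... | no _ | yes q = ⊥-elim (ι∉Bτ (subst (λ x → inVτ (inj₁ x)) q p))
      ... | no b | no a = inj₁ (vX c (v , fromWitnessFalse a , fromWitnessFalse b))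

      BE : Side → Set
      BE σ = Σ[ f ∈ Graph.E (barX c) ] side f ≡ σ

      bcolR : ∀ {σ} → BE σ → Col
      bcolR ((e , σ') , _) = barCol (σ' , col (X c) e)

      Rι : RGraph (cι c)
      Rι = record { RE = BE sι ; rcol = bcolR ; rsrc = rs ; rtgt = rt }
        where
        rs : (r : BE sι) → End (cι c) (proj₁ (κ (bcolR r)))
        rs ((e , sι) , p) = renι (src (X c) e) (proj₁ (subι (e , sι) p))
        rs ((e , sτ) , p) = inj₂ (eX c e)
        rt : (r : BE sι) → End (cι c) (proj₂ (κ (bcolR r)))
        rt ((e , sι) , p) = inj₂ (eX c e)
        rt ((e , sτ) , p) = renι (tgt (X c) e) (proj₂ (subι (e , sτ) p))

      Rτ : RGraph (cτ c)
      Rτ = record { RE = BE sτ ; rcol = bcolR ; rsrc = rs ; rtgt = rt }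
        where
        rs : (r : BE sτ) → End (cτ c) (proj₁ (κ (bcolR r)))
        rs ((e , sι) , p) = renτ (src (X c) e) (proj₁ (subτ (e , sι) p))
        rs ((e , sτ) , p) = inj₁ (eX c e)
        rt : (r : BE sτ) → End (cτ c) (proj₂ (κ (bcolR r)))
        rt ((e , sι) , p) = inj₁ (eX c e)
        rt ((e , sτ) , p) = renτ (tgt (X c) e) (proj₂ (subτ (e , sτ) p))

    R₀ : RGraph c₀
    R₀ = record { RE = Fin (nE X₀) × Side ; rcol = rc ; rsrc = rs ; rtgt = rt }
      where
      rc : Fin (nE X₀) × Side → Col
      rc (e , σ) = barCol (σ , col X₀ e)
      rs : (r : Fin (nE X₀) × Side) → End c₀ (proj₁ (κ (rc r)))
      rs (e , sι) = inj₁ (v0 (src X₀ e))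
      rs (e , sτ) = inj₁ (e0 e)
      rt : (r : Fin (nE X₀) × Side) → End c₀ (proj₂ (κ (rc r)))
      rt (e , sι) = inj₂ (e0 e)
      rt (e , sτ) = inj₂ (v0 (tgt X₀ e))

    R : (c : Col) → RGraph c
    R c₀ = R₀
    R (cι c) = Rι c
    R (cτ c) = Rτ c

    expand : ∀ {n} → TGraph n → TGraph (suc n)
    expand {n} G = record { GE = GE' ; gcol = gc ; gsrc = gs ; gtgt = gt }
      where
      open TGraph G
      GE' : Set
      GE' = Σ[ g ∈ GE ] RGraph.RE (R (gcol g))
      plug : ∀ {a} (g : GE) → End (gcol g) a → Word (suc n) a
      plug g (inj₁ y) = gsrc g ▷ y
      plug g (inj₂ y) = gtgt g ▷ y
      gc : GE' → Col
      gc (g , r) = RGraph.rcol (R (gcol g)) r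
      gs : (x : GE') → Word (suc n) (proj₁ (κ (gc x)))
      gs (g , r) = plug g (RGraph.rsrc (R (gcol g)) r)
      gt : (x : GE') → Word (suc n) (proj₂ (κ (gc x)))
      gt (g , r) = plug g (RGraph.rtgt (R (gcol g)) r)

    Γ : (n : ℕ) → TGraph n
    Γ zero = record { GE = ⊤ ; gcol = λ _ → c₀ ; gsrc = λ _ → ε ; gtgt = λ _ → ε }
    Γ (suc n) = expand (Γ n)

    srcV : ∀ {n} → TGraph.GE (Γ n) → Vtx n
    srcV {n} g = proj₁ (κ (TGraph.gcol (Γ n) g)) , TGraph.gsrc (Γ n) g
    tgtV : ∀ {n} → TGraph.GE (Γ n) → Vtx n
    tgtV {n} g = proj₂ (κ (TGraph.gcol (Γ n) g)) , TGraph.gtgt (Γ n) g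

  toEW : ∀ {n c} → Word n (vc c) → EW n c
  toEW (ε ▷ e0 e) = base e
  toEW ((w ▷ ()) ▷ e0 e)
  toEW (w ▷ eX c e) = toEW w ∷ʳ e

  toEV : ∀ {n} → Word n ⋆ → EV n
  toEV (ε ▷ v0 v) = vb v
  toEV ((w ▷ ()) ▷ v0 v)
  toEV (w ▷ eV) = old (toEV w)
  toEV (w ▷ vX c i) = new (toEW w) i

  φ : ∀ {n} → Vtx (suc n) → Graph.V (bar (Egraph (suc n)))
  φ (vc c , w) = inj₂ (c , toEW w)
  φ (⋆ , w) = inj₁ (toEV w)
  φ (s , _ ▷ ())

-- An edge of
-- Γ_{n+1} is a pair (g , r) of an edge g of Γ_n and an edge r of R_{col g}.
-- If g is the half-edge (w , σ) of bar(E_n) and w has colour c, then r is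
-- an edge (e , σ') of bar(X_c) lying in B_σ, and (g , r) corresponds to the
-- half-edge (w e , σ') of bar(E_{n+1}); since bar(X_c) is the disjoint
-- union of B_ι and B_τ this is a bijection.  The endpoints agree because
-- the renamings defining R_{c_ι} and R_{c_τ} send ι_c, τ_c to the old
-- endpoints of w and interior vertices v to w v, exactly as E_{n+1} places
-- the vertices of the copy of X_c; the partition axioms exclude τ_c ∈ B_ι
-- and ι_c ∈ B_τ, where the two would disagree.
module Submission where

open import Defs
open import Data.Nat using (ℕ; zero; suc)
open import Data.Fin using (Fin; _≟_)
open import Data.Product using (Σ; _×_; _,_; proj₁; proj₂; Σ-syntax)
open import Data.Product.Function.Dependent.Propositional using (Σ-↔)
open import Data.Sum using (inj₁; inj₂)
open import Data.Sum.Properties using (inj₁-injective)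
open import Data.Unit using (tt)
open import Data.Empty using (⊥-elim)
open import Relation.Nullary using (yes; no)
open import Relation.Binary.PropositionalEquality using (_≡_; refl; cong; subst)
open import Function.Base using (_∘_)
open import Function.Bundles using (_↔_; Inverse; Bijection; mk↔ₛ′)
open import Function.Properties.Inverse using (↔-trans; ↔⇒⤖)
open import Function.Related.Propositional using (≡⇒; bijection)
open import Function.Definitions using (Bijective)

module _ (ℰ : ERS) where
  open ERS ℰ
  open FinCGraph

  barE : ℕ → Graph (Side × Fin nC)
  barE m = bar (Egraph ℰ m)

  fromEW : ∀ {m c} → EW ℰ m c → Word ℰ m (vc c)
  fromEW (base e) = ε ▷ e0 e
  fromEW (w ∷ʳ e) = fromEW w ▷ eX _ e

  fromEV : ∀ {m} → EV ℰ m → Word ℰ m ⋆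
  fromEV (vb v) = ε ▷ v0 v
  fromEV (old x) = fromEV x ▷ eV
  fromEV (new w i) = fromEW w ▷ vX _ i

  -- toEW and toEV only compute once the prefix of the word is a constructor,
  -- hence the extra case splits below.
  toEW-fromEW : ∀ {m c} (w : EW ℰ m c) → toEW ℰ (fromEW w) ≡ w
  toEW-fromEW (base e) = refl
  toEW-fromEW (base _ ∷ʳ e) = refl
  toEW-fromEW ((w ∷ʳ e′) ∷ʳ e) = cong (_∷ʳ e) (toEW-fromEW (w ∷ʳ e′))

  fromEW-toEW : ∀ {m c} (w : Word ℰ m (vc c)) → fromEW (toEW ℰ w) ≡ w
  fromEW-toEW (ε ▷ e0 e) = refl
  fromEW-toEW ((w ▷ ()) ▷ e0 e)
  fromEW-toEW ((w ▷ x) ▷ eX c e) = cong (_▷ eX c e) (fromEW-toEW (w ▷ x))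

  toEV-fromEV : ∀ {m} (x : EV ℰ m) → toEV ℰ (fromEV x) ≡ x
  toEV-fromEV (vb v) = refl
  toEV-fromEV (old (vb v)) = refl
  toEV-fromEV (old (old x)) = cong old (toEV-fromEV (old x))
  toEV-fromEV (old (new w i)) = cong old (toEV-fromEV (new w i))
  toEV-fromEV (new (base e) i) = refl
  toEV-fromEV (new (w ∷ʳ e) i) = cong (λ w′ → new w′ i) (toEW-fromEW (w ∷ʳ e))

  fromEV-toEV : ∀ {m} (w : Word ℰ m ⋆) → fromEV (toEV ℰ w) ≡ w
  fromEV-toEV (ε ▷ v0 v) = refl
  fromEV-toEV ((w ▷ ()) ▷ v0 v)
  fromEV-toEV ((w ▷ x) ▷ eV) = cong (_▷ eV) (fromEV-toEV (w ▷ x))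
  fromEV-toEV ((w ▷ x) ▷ vX c i) = cong (_▷ vX c i) (fromEW-toEW (w ▷ x))

  φ-inverse : ∀ n → Vtx ℰ (suc n) ↔ Graph.V (barE (suc n))
  φ-inverse n = mk↔ₛ′ (φ ℰ) φ⁻¹ φ-φ⁻¹ φ⁻¹-φ
    where
    φ⁻¹ : Graph.V (barE (suc n)) → Vtx ℰ (suc n)
    φ⁻¹ (inj₁ x) = ⋆ , fromEV x
    φ⁻¹ (inj₂ (c , w)) = vc c , fromEW w
    φ-φ⁻¹ : ∀ y → φ ℰ (φ⁻¹ y) ≡ y
    φ-φ⁻¹ (inj₁ x) = cong inj₁ (toEV-fromEV x)
    φ-φ⁻¹ (inj₂ (c , w)) = cong (λ w′ → inj₂ (c , w′)) (toEW-fromEW w)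
    φ⁻¹-φ : ∀ x → φ⁻¹ (φ ℰ x) ≡ x
    φ⁻¹-φ (vc c , w) = cong (vc c ,_) (fromEW-toEW w)
    φ⁻¹-φ (⋆ , w) = cong (⋆ ,_) (fromEV-toEV w)
    φ⁻¹-φ (s , (_ ▷ ()))

  module _ (P : (c : Fin nC) → Partition ℰ c) where
    open VERS ℰ P
    open Partition

    REdge : Col ℰ → Set
    REdge k = RGraph.RE (R k)

    barColour : ∀ {m} → Graph.E (barE m) → Col ℰ
    barColour {m} b = barCol ℰ (Graph.col (barE m) b)

    -- REdge (barCol (σ , c)) reduces to the edges of B_σ only once σ is a constructor.
    asREdge : ∀ c σ (f : Graph.E (barX ℰ c)) → side (P c) f ≡ σ → REdge (barCol ℰ (σ , c))
    asREdge c sι f p = f , p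
    asREdge c sτ f p = f , p

    module _ {m : ℕ} where

      extendBarEdge : Σ (Graph.E (barE (suc m))) (REdge ∘ barColour) → Graph.E (barE (suc (suc m)))
      extendBarEdge (((c , w) , sι) , ((e , σ) , _)) = (col (X c) e , w ∷ʳ e) , σ
      extendBarEdge (((c , w) , sτ) , ((e , σ) , _)) = (col (X c) e , w ∷ʳ e) , σ

      splitBarEdge : Graph.E (barE (suc (suc m))) → Σ (Graph.E (barE (suc m))) (REdge ∘ barColour)
      splitBarEdge ((_ , _∷ʳ_ {c = c} w e) , σ) =
        ((c , w) , side (P c) (e , σ)) , asREdge c _ (e , σ) refl

      extendBarEdge-asREdge : ∀ {c} (w : EW ℰ (suc m) c) e σ σ′ (p : side (P c) (e , σ) ≡ σ′) →
        extendBarEdge (((c , w) , σ′) , asREdge c σ′ (e , σ) p) ≡ ((col (X c) e , w ∷ʳ e) , σ)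
      extendBarEdge-asREdge w e σ sι p = refl
      extendBarEdge-asREdge w e σ sτ p = refl

      asREdge-unique : ∀ {c} (w : EW ℰ (suc m) c) f {σ σ′}
        (p : side (P c) f ≡ σ) (p′ : side (P c) f ≡ σ′) →
        _≡_ {A = Σ (Graph.E (barE (suc m))) (REdge ∘ barColour)}
          (((c , w) , σ) , asREdge c σ f p) (((c , w) , σ′) , asREdge c σ′ f p′)
      asREdge-unique w f refl refl = refl

      barEdge-expansion : Σ (Graph.E (barE (suc m))) (REdge ∘ barColour) ↔ Graph.E (barE (suc (suc m)))
      barEdge-expansion = mk↔ₛ′ extendBarEdge splitBarEdge extend-split split-extend
        where
        extend-split : ∀ b → extendBarEdge (splitBarEdge b) ≡ b
        extend-split ((_ , w ∷ʳ e) , σ) = extendBarEdge-asREdge w e σ _ refl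
        split-extend : ∀ x → splitBarEdge (extendBarEdge x) ≡ x
        split-extend (((c , w) , sι) , ((e , σ) , p)) = asREdge-unique w (e , σ) refl p
        split-extend (((c , w) , sτ) , ((e , σ) , p)) = asREdge-unique w (e , σ) refl p

      plug : ∀ {k a} → Word ℰ (suc m) (proj₁ (κ ℰ k)) → Word ℰ (suc m) (proj₂ (κ ℰ k)) →
             End ℰ k a → Word ℰ (suc (suc m)) a
      plug sw tw (inj₁ y) = sw ▷ y
      plug sw tw (inj₂ y) = tw ▷ y

      module _ (G : TGraph ℰ (suc m)) where
        open TGraph G

        -- expand plugs endpoints with a function local to its definition.
        expand-gsrc : ∀ g r → TGraph.gsrc (expand G) (g , r)
                              ≡ plug {k = gcol g} (gsrc g) (gtgt g) (RGraph.rsrc (R (gcol g)) r)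
        expand-gsrc g r with RGraph.rsrc (R (gcol g)) r
        ... | inj₁ _ = refl
        ... | inj₂ _ = refl

        expand-gtgt : ∀ g r → TGraph.gtgt (expand G) (g , r)
                              ≡ plug {k = gcol g} (gsrc g) (gtgt g) (RGraph.rtgt (R (gcol g)) r)
        expand-gtgt g r with RGraph.rtgt (R (gcol g)) r
        ... | inj₁ _ = refl
        ... | inj₂ _ = refl

      renι-place : ∀ {c} (sw : Word ℰ (suc m) ⋆) (tw : Word ℰ (suc m) (vc c)) →
        toEV ℰ sw ≡ ιE ℰ (toEW ℰ tw) → ∀ v p →
        toEV ℰ (plug {k = cι c} sw tw (renι c v p)) ≡ place ℰ (toEW ℰ tw) v
      renι-place {c} (_ ▷ _) (_ ▷ _) hs v p with v ≟ ιc c | v ≟ τc c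
      ... | yes _ | _ = cong old hs
      ... | no _ | yes v≡τ = ⊥-elim (τ∉Bι (P c) (subst (λ x → inVι (P c) (inj₁ x)) v≡τ p))
      ... | no _ | no _ = refl

      renτ-place : ∀ {c} (sw : Word ℰ (suc m) (vc c)) (tw : Word ℰ (suc m) ⋆) →
        toEV ℰ tw ≡ τE ℰ (toEW ℰ sw) → ∀ v p →
        toEV ℰ (plug {k = cτ c} sw tw (renτ c v p)) ≡ place ℰ (toEW ℰ sw) v
      renτ-place {c} (_ ▷ _) (_ ▷ _) ht v p with v ≟ ιc c | v ≟ τc c
      ... | yes v≡ι | _ = ⊥-elim (ι∉Bτ (P c) (subst (λ x → inVτ (P c) (inj₁ x)) v≡ι p))
      ... | no _ | yes _ = cong old ht
      ... | no _ | no _ = refl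

    Represents : ∀ {m} k → Word ℰ (suc m) (proj₁ (κ ℰ k)) → Word ℰ (suc m) (proj₂ (κ ℰ k)) →
                 Graph.E (barE (suc m)) → Set
    Represents {m} k sw tw b =
      k ≡ barColour b
      × φ ℰ (proj₁ (κ ℰ k) , sw) ≡ Graph.ι (barE (suc m)) b
      × φ ℰ (proj₂ (κ ℰ k) , tw) ≡ Graph.τ (barE (suc m)) b

    REdge-cong : ∀ {k k′} → k ≡ k′ → REdge k ↔ REdge k′
    REdge-cong eq = ≡⇒ {k = bijection} (cong REdge eq)

    expand-represents : ∀ {m} k sw tw (b : Graph.E (barE (suc m))) (rep : Represents k sw tw b) r →
      Represents (RGraph.rcol (R k) r) (plug {k = k} sw tw (RGraph.rsrc (R k) r))
                 (plug {k = k} sw tw (RGraph.rtgt (R k) r))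
                 (extendBarEdge (b , Inverse.to (REdge-cong (proj₁ rep)) r))
    expand-represents _ sw (_ ▷ _) ((c , _) , sι) (refl , hs , refl) ((e , sι) , p) =
      refl , cong inj₁ (renι-place sw _ (inj₁-injective hs) _ (proj₁ (subι (P c) (e , sι) p))) , refl
    expand-represents _ sw (_ ▷ _) ((c , _) , sι) (refl , hs , refl) ((e , sτ) , p) =
      refl , refl , cong inj₁ (renι-place sw _ (inj₁-injective hs) _ (proj₂ (subι (P c) (e , sτ) p)))
    expand-represents _ (_ ▷ _) tw ((c , _) , sτ) (refl , refl , ht) ((e , sι) , p) =
      refl , cong inj₁ (renτ-place _ tw (inj₁-injective ht) _ (proj₁ (subτ (P c) (e , sι) p))) , refl
    expand-represents _ (_ ▷ _) tw ((c , _) , sτ) (refl , refl , ht) ((e , sτ) , p) =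
      refl , refl , cong inj₁ (renτ-place _ tw (inj₁-injective ht) _ (proj₂ (subτ (P c) (e , sτ) p)))

    record BarIso {m} (G : TGraph ℰ (suc m)) : Set₁ where
      open TGraph G
      field
        edges : GE ↔ Graph.E (barE (suc m))
        represents : ∀ g → Represents (gcol g) (gsrc g) (gtgt g) (Inverse.to edges g)

    barIso-Γ₁ : BarIso (Γ 1)
    barIso-Γ₁ = record { edges = mk↔ₛ′ ψ θ ψ-θ (λ _ → refl) ; represents = ψ-represents }
      where
      ψ : TGraph.GE (Γ 1) → Graph.E (barE 1)
      ψ (tt , (e , σ)) = (col X₀ e , base e) , σ
      θ : Graph.E (barE 1) → TGraph.GE (Γ 1)
      θ ((_ , base e) , σ) = tt , (e , σ)
      ψ-θ : ∀ b → ψ (θ b) ≡ b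
      ψ-θ ((_ , base e) , σ) = refl
      ψ-represents : ∀ g → Represents (TGraph.gcol (Γ 1) g) (TGraph.gsrc (Γ 1) g)
                                      (TGraph.gtgt (Γ 1) g) (ψ g)
      ψ-represents (tt , (e , sι)) = refl , refl , refl
      ψ-represents (tt , (e , sτ)) = refl , refl , refl

    barIso-expand : ∀ {m} {G : TGraph ℰ (suc m)} → BarIso G → BarIso (expand G)
    barIso-expand {G = G} I = record { edges = edges′ ; represents = represents′ }
      where
      open TGraph G
      open BarIso I
      edges′ : TGraph.GE (expand G) ↔ Graph.E (barE _)
      edges′ = ↔-trans (Σ-↔ edges (λ {g} → REdge-cong (proj₁ (represents g)))) barEdge-expansion
      represents′ : ∀ x → Represents (TGraph.gcol (expand G) x) (TGraph.gsrc (expand G) x)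
                                     (TGraph.gtgt (expand G) x) (Inverse.to edges′ x)
      represents′ (g , r) rewrite expand-gsrc G g r | expand-gtgt G g r =
        expand-represents (gcol g) (gsrc g) (gtgt g) _ (represents g) r

    barIso-Γ : ∀ n → BarIso (Γ (suc n))
    barIso-Γ zero = barIso-Γ₁
    barIso-Γ (suc n) = barIso-expand (barIso-Γ n)

corollary6p11 : (ℰ : ERS) (P : (c : Fin (ERS.nC ℰ)) → Partition ℰ c) (n : ℕ) →
    Bijective _≡_ _≡_ (φ ℰ {n})
    × Σ[ ψ ∈ (TGraph.GE (VERS.Γ ℰ P (suc n)) → Graph.E (bar (Egraph ℰ (suc n)))) ]
        ( Bijective _≡_ _≡_ ψ
        × (∀ g → φ ℰ (VERS.srcV ℰ P g) ≡ Graph.ι (bar (Egraph ℰ (suc n))) (ψ g))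
        × (∀ g → φ ℰ (VERS.tgtV ℰ P g) ≡ Graph.τ (bar (Egraph ℰ (suc n))) (ψ g))
        × (∀ g → TGraph.gcol (VERS.Γ ℰ P (suc n)) g
                   ≡ barCol ℰ (Graph.col (bar (Egraph ℰ (suc n))) (ψ g))) )
corollary6p11 ℰ P n =
  Bijection.bijective (↔⇒⤖ (φ-inverse ℰ n))
  , Inverse.to edges
  , Bijection.bijective (↔⇒⤖ edges)
  , (λ g → proj₁ (proj₂ (represents g)))
  , (λ g → proj₂ (proj₂ (represents g)))
  , (λ g → proj₁ (represents g))
  where open BarIso (barIso-Γ ℰ P n)
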